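{- Let $s,t,n\in\mathbb{N}$. Suppose that $G$ is a graph on $n$ vertices such that $\delta(G)\ge n-t$, and let $s$ denote the number of vertices of degree $\delta(G)$ in $G$. Suppose that $n\ge s+3t+2t(\Delta(G)-\delta(G))$. Then: (a) if $\delta(G)$ is even then $G$ contains a $\delta(G)$-factor; (b) if $\delta(G)$ is odd then there is an optimal matching $M$ in $G$ such that $G-M$ contains a $(\delta(G)-1)$-factor.
   Context: $\delta(G)$ and $\Delta(G)$ are the minimum and maximum degree of $G$. An $r$-factor of a graph is a spanning $r$-regular subgraph. A matching is optimal if it covers all but at most one vertex of $G$; $G-M$ denotes $G$ with the edges of $M$ removed. -}

module Defs where

open import Data.Nat using (ℕ; _+_; _≤_; _≡ᵇ_)
open import Data.Bool using (Bool; true; false; if_then_else_; _∧_; not)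
open import Data.Fin using (Fin)
open import Data.List using (List; map; allFin)
open import Data.Nat.ListAction using (sum)
open import Data.Product using (∃; _×_)
open import Relation.Binary.PropositionalEquality using (_≡_; cong; cong₂)

record Graph (n : ℕ) : Set where
  field
    adj    : Fin n → Fin n → Bool
    adj-sym    : ∀ u v → adj u v ≡ adj v u
    adj-irrefl : ∀ v → adj v v ≡ false
open Graph public

countᵇ : {n : ℕ} → (Fin n → Bool) → ℕ
countᵇ {n} p = sum (map (λ u → if p u then 1 else 0) (allFin n))

degree : {n : ℕ} → Graph n → Fin n → ℕ
degree G v = countᵇ (adj G v)

IsMinDegree : {n : ℕ} → Graph n → ℕ → Set
IsMinDegree G d = (∃ λ v → degree G v ≡ d) × (∀ v → d ≤ degree G v)

IsMaxDegree : {n : ℕ} → Graph n → ℕ → Set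
IsMaxDegree G D = (∃ λ v → degree G v ≡ D) × (∀ v → degree G v ≤ D)

numVerticesOfDegree : {n : ℕ} → Graph n → ℕ → ℕ
numVerticesOfDegree G d = countᵇ (λ v → (degree G v) ≡ᵇ d)

_⊆ᴳ_ : {n : ℕ} → Graph n → Graph n → Set
H ⊆ᴳ G = ∀ u v → adj H u v ≡ true → adj G u v ≡ true

IsRegular : {n : ℕ} → ℕ → Graph n → Set
IsRegular r H = ∀ v → degree H v ≡ r

HasFactor : {n : ℕ} → ℕ → Graph n → Set
HasFactor {n} r G = ∃ λ (H : Graph n) → (H ⊆ᴳ G) × IsRegular r H

IsMatching : {n : ℕ} → Graph n → Graph n → Set
IsMatching G M = (M ⊆ᴳ G) × (∀ v → degree M v ≤ 1)

IsOptimalMatching : {n : ℕ} → Graph n → Graph n → Set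
IsOptimalMatching G M =
  IsMatching G M × (countᵇ (λ v → (degree M v) ≡ᵇ 0) ≤ 1)

_─ᴱ_ : {n : ℕ} → Graph n → Graph n → Graph n
G ─ᴱ M = record
  { adj = λ u v → adj G u v ∧ not (adj M u v)
  ; adj-sym = λ u v → cong₂ (λ a b → a ∧ not b) (adj-sym G u v) (adj-sym M u v)
  ; adj-irrefl = λ v → cong (λ a → a ∧ not (adj M v v)) (adj-irrefl G v)
  }

module Submission where

open import Defs
open import Data.Nat using (ℕ; zero; suc; _+_; _*_; _∸_; _≤_; _<_; z≤n; s≤s; _≡ᵇ_; _<ᵇ_; _<?_; _%_; _/_)
open import Data.Nat.Properties hiding (_≟_)
open import Data.Nat.Divisibility using (_∣_; divides; ∣m∣n⇒∣m+n; ∣m+n∣m⇒∣n; m%n≡0⇒n∣m; ∣n⇒∣m*n)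
open import Data.Nat.DivMod using (m≡m%n+[m/n]*n; m%n<n)
open import Data.Nat.Tactic.RingSolver using (solve-∀)
open import Data.Nat.ListAction as List using ()
open import Algebra.Properties.Semiring.Sum +-*-semiring
  using (sum; sum-cong-≗; ∑-distrib-+; ∑-comm; sum-remove; *-distribˡ-sum; *-distribʳ-sum)
open import Data.Bool using (Bool; true; false; if_then_else_; _∧_; _∨_; not; T)
open import Data.Bool.Properties using (∧-comm; ∨-comm; ∧-conical; ∨-conical; ¬-not)
import Data.Bool.Properties as Bool
open import Data.Fin using (Fin; zero; suc; _≟_; punchIn)
open import Data.Fin.Properties using (any?; punchInᵢ≢i)
open import Data.List using (tabulate)
open import Data.List.Properties using (map-tabulate)
open import Data.Product using (∃; ∃₂; _×_; _,_; proj₁; proj₂)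
open import Data.Sum using (_⊎_; inj₁; inj₂)
open import Data.Empty using (⊥; ⊥-elim)
open import Relation.Nullary using (yes; no; does; contradiction)
open import Relation.Nullary.Decidable using (dec-true; dec-false)
open import Relation.Binary.PropositionalEquality
open import Function using (_∘_)

-- Put m = Δ − δ and f = deg_G − δ.  The heart of the proof is a dense
-- f-factor lemma (module DenseFactor): if every vertex misses at most t others,
-- f ≤ m, f vanishes on at most s vertices, s + (t + m)(m + 2) ≤ n and Σ f is
-- even, then G has a spanning subgraph K with deg K = f.  For even δ, G − K is
-- the δ-factor.  For odd δ we raise f by one at a vertex of minimum degree when
-- n is odd; G − K then has degree δ on an even set A missing at most that
-- vertex and δ − 1 off A, and a dense matching lemma (module DenseMatching:
-- minimum degree d inside A and |A| ≤ 2d + 1 give a perfect matching of A)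
-- supplies M.  Both lemmas are proved by augmentation (factor-by-augmentation),
-- using double counting to show that an augmenting step always exists.

-- Finite sums over Fin n are the library's semiring sums over ℕ; note that
-- `sum {suc n} g` unfolds to `g zero + sum (g ∘ suc)`.

sum-mono-≤ : ∀ {n} {g h : Fin n → ℕ} → (∀ x → g x ≤ h x) → sum g ≤ sum h
sum-mono-≤ {zero}  le = z≤n
sum-mono-≤ {suc n} le = +-mono-≤ (le zero) (sum-mono-≤ (le ∘ suc))

sum-const : ∀ n c → sum {n} (λ _ → c) ≡ n * c
sum-const zero    c = refl
sum-const (suc n) c = cong (c +_) (sum-const n c)

term≤sum : ∀ {n} (g : Fin n → ℕ) (x : Fin n) → g x ≤ sum g
term≤sum g zero    = m≤m+n _ _
term≤sum g (suc x) = ≤-trans (term≤sum (g ∘ suc) x) (m≤n+m _ _)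

sum-<⇒∃ : ∀ {n} (g h : Fin n → ℕ) → sum g < sum h → ∃ λ x → g x < h x
sum-<⇒∃ {zero}  g h ()
sum-<⇒∃ {suc n} g h lt with g zero <? h zero
... | yes p = zero , p
... | no ¬p =
  let (x , q) = sum-<⇒∃ (g ∘ suc) (h ∘ suc)
        (+-cancelˡ-< (h zero) _ _ (≤-<-trans (+-monoˡ-≤ (sum (g ∘ suc)) (≮⇒≥ ¬p)) lt))
  in suc x , q

sum-squeeze : ∀ {n} (g h : Fin n → ℕ) → (∀ x → g x ≤ h x) → sum h ≤ sum g → ∀ x → g x ≡ h x
sum-squeeze g h le ge x with g x <? h x
... | no ¬p = ≤-antisym (le x) (≮⇒≥ ¬p)
... | yes p = contradiction ge (<⇒≱ (strict g h le x p))
  where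
  strict : ∀ {n} (g h : Fin n → ℕ) → (∀ x → g x ≤ h x) → ∀ x → g x < h x → sum g < sum h
  strict g h le zero    p = +-mono-<-≤ p (sum-mono-≤ (le ∘ suc))
  strict g h le (suc x) p = +-mono-≤-< (le zero) (strict (g ∘ suc) (h ∘ suc) (le ∘ suc) x p)

sum-agree-off : ∀ {n} (g h : Fin n → ℕ) (u : Fin n) → (∀ z → z ≢ u → g z ≡ h z) →
  sum g + h u ≡ sum h + g u
sum-agree-off {suc n} g h u agree = begin
  sum g + h u                       ≡⟨ cong (_+ h u) (sum-remove {i = u} g) ⟩
  g u + sum (g ∘ punchIn u) + h u   ≡⟨ cong (λ a → g u + a + h u) (sum-cong-≗ off) ⟩
  g u + sum (h ∘ punchIn u) + h u   ≡⟨ swap-outer (g u) (sum (h ∘ punchIn u)) (h u) ⟩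
  h u + sum (h ∘ punchIn u) + g u   ≡⟨ cong (_+ g u) (sym (sum-remove {i = u} h)) ⟩
  sum h + g u                       ∎
  where
  open ≡-Reasoning
  off : ∀ j → g (punchIn u j) ≡ h (punchIn u j)
  off j = agree (punchIn u j) (punchInᵢ≢i u j)
  swap-outer : ∀ a b c → a + b + c ≡ c + b + a
  swap-outer = solve-∀

𝟙 : Bool → ℕ
𝟙 b = if b then 1 else 0

𝟙-not : ∀ b → 𝟙 b + 𝟙 (not b) ≡ 1
𝟙-not false = refl
𝟙-not true  = refl

𝟙-∧ : ∀ a b → 𝟙 (a ∧ b) ≡ 𝟙 a * 𝟙 b
𝟙-∧ false b = refl
𝟙-∧ true  b = sym (+-identityʳ (𝟙 b))

∧-true : ∀ a {b} → (a ∧ b) ≡ true → a ≡ true × b ≡ true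
∧-true a {b} h = proj₁ ∧-conical a b h , proj₂ ∧-conical a b h

∨-false : ∀ a {b} → (a ∨ b) ≡ false → a ≡ false × b ≡ false
∨-false a {b} h = proj₁ ∨-conical a b h , proj₂ ∨-conical a b h

not-false : ∀ {a} → not a ≡ false → a ≡ true
not-false {a} h = Bool.not-injective h

not-true : ∀ {a} → not a ≡ true → a ≡ false
not-true {a} h = Bool.not-injective h

<ᵇ-true : ∀ {a b} → (a <ᵇ b) ≡ true → a < b
<ᵇ-true {a} {b} h = <ᵇ⇒< a b (subst T (sym h) _)

<ᵇ-false : ∀ {a b} → (a <ᵇ b) ≡ false → b ≤ a
<ᵇ-false h = ≮⇒≥ (λ a<b → contradiction (trans (sym h) (T⇒true (<⇒<ᵇ a<b))) λ ())
  where
  T⇒true : ∀ {b} → T b → b ≡ true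
  T⇒true {true} _ = refl

_==_ : ∀ {n} → Fin n → Fin n → Bool
x == y = does (x ≟ y)

==-refl : ∀ {n} (x : Fin n) → (x == x) ≡ true
==-refl x = dec-true (x ≟ x) refl

==⇒≡ : ∀ {n} {x y : Fin n} → (x == y) ≡ true → x ≡ y
==⇒≡ {x = x} {y} eq with x ≟ y
... | yes x≡y = x≡y

≢⇒==false : ∀ {n} {x y : Fin n} → x ≢ y → (x == y) ≡ false
≢⇒==false {x = x} {y} = dec-false (x ≟ y)

==false⇒≢ : ∀ {n} {x y : Fin n} → (x == y) ≡ false → x ≢ y
==false⇒≢ {x = x} h refl = contradiction (trans (sym h) (==-refl x)) λ ()

==-∧-distinct : ∀ {n} {u v : Fin n} (x : Fin n) → u ≢ v → (x == u ∧ x == v) ≡ false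
==-∧-distinct {u = u} {v} x u≢v with x ≟ u
... | yes refl = ≢⇒==false u≢v
... | no  _    = refl

search : ∀ {n} (p : Fin n → Bool) → (∃ λ x → p x ≡ true) ⊎ (∀ x → p x ≡ false)
search p with any? (λ x → p x Bool.≟ true)
... | yes found = inj₁ found
... | no  none  = inj₂ (λ x → ¬-not (λ px → none (x , px)))

search₂ : ∀ {n} (r : Fin n → Fin n → Bool) → (∃₂ λ x y → r x y ≡ true) ⊎ (∀ x y → r x y ≡ false)
search₂ r with any? (λ x → any? (λ y → r x y Bool.≟ true))
... | yes (x , y , rxy) = inj₁ (x , y , rxy)
... | no  none          = inj₂ (λ x y → ¬-not (λ rxy → none (x , y , rxy)))

count : ∀ {n} → (Fin n → Bool) → ℕ
count p = sum (λ x → 𝟙 (p x))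

countᵇ≡count : ∀ {n} (p : Fin n → Bool) → countᵇ p ≡ count p
countᵇ≡count {n} p = trans (cong List.sum (map-tabulate (λ x → x) (𝟙 ∘ p))) (list-sum (𝟙 ∘ p))
  where
  list-sum : ∀ {n} (g : Fin n → ℕ) → List.sum (tabulate g) ≡ sum g
  list-sum {zero}  g = refl
  list-sum {suc n} g = cong (g zero +_) (list-sum (g ∘ suc))

count-complement : ∀ {n} (p : Fin n → Bool) → count p + count (not ∘ p) ≡ n
count-complement {n} p = begin
  count p + count (not ∘ p)            ≡⟨ ∑-distrib-+ (𝟙 ∘ p) (𝟙 ∘ not ∘ p) ⟨
  sum (λ x → 𝟙 (p x) + 𝟙 (not (p x)))  ≡⟨ sum-cong-≗ (λ x → 𝟙-not (p x)) ⟩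
  sum {n} (λ _ → 1)                    ≡⟨ sum-const n 1 ⟩
  n * 1                                ≡⟨ *-identityʳ n ⟩
  n                                    ∎
  where open ≡-Reasoning

count≤n : ∀ {n} (p : Fin n → Bool) → count p ≤ n
count≤n p = subst (count p ≤_) (count-complement p) (m≤m+n _ _)

count-split : ∀ {n} (p q : Fin n → Bool) →
  count (λ x → p x ∧ q x) + count (λ x → p x ∧ not (q x)) ≡ count p
count-split p q =
  trans (sym (∑-distrib-+ (λ x → 𝟙 (p x ∧ q x)) (λ x → 𝟙 (p x ∧ not (q x)))))
        (sum-cong-≗ (λ x → split (p x) (q x)))
  where
  split : ∀ a b → 𝟙 (a ∧ b) + 𝟙 (a ∧ not b) ≡ 𝟙 a
  split false b     = refl
  split true  false = refl
  split true  true  = refl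

count-mono : ∀ {n} (p q : Fin n → Bool) → (∀ x → p x ≡ true → q x ≡ true) → count p ≤ count q
count-mono p q p⇒q = sum-mono-≤ (λ x → mono (p x) (q x) (p⇒q x))
  where
  mono : ∀ a b → (a ≡ true → b ≡ true) → 𝟙 a ≤ 𝟙 b
  mono false b     _ = z≤n
  mono true  b a⇒b rewrite a⇒b refl = ≤-refl

count-∨ : ∀ {n} (p q : Fin n → Bool) → count (λ x → p x ∨ q x) ≤ count p + count q
count-∨ p q = ≤-trans (sum-mono-≤ (λ x → union (p x) (q x))) (≤-reflexive (∑-distrib-+ (𝟙 ∘ p) (𝟙 ∘ q)))
  where
  union : ∀ a b → 𝟙 (a ∨ b) ≤ 𝟙 a + 𝟙 b
  union false b = ≤-refl
  union true  b = s≤s z≤n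

count-none : ∀ {n} (p : Fin n → Bool) → (∀ x → p x ≡ false) → count p ≡ 0
count-none {n} p none = trans (sum-cong-≗ (λ x → cong 𝟙 (none x))) (trans (sum-const n 0) (*-zeroʳ n))

count-zero : ∀ {n} (p : Fin n → Bool) → count p ≡ 0 → ∀ x → p x ≡ false
count-zero p c≡0 x with p x in px
... | false = refl
... | true  = contradiction (subst (1 ≤_) c≡0 (subst (_≤ count p) (cong 𝟙 px) (term≤sum (𝟙 ∘ p) x))) λ ()

count-== : ∀ {n} (u : Fin n) → count (_== u) ≡ 1
count-== {suc n} zero    = cong suc (count-none (λ (x : Fin n) → suc x == zero) (λ x → ≢⇒==false {x = suc x} {zero} λ ()))
count-== {suc n} (suc u) = count-== u

deg : ∀ {n} → Graph n → Fin n → ℕ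
deg K x = count (adj K x)

degIn : ∀ {n} → Graph n → Fin n → (Fin n → Bool) → ℕ
degIn K x Q = count (λ y → adj K x y ∧ Q y)

degree≡deg : ∀ {n} (K : Graph n) (x : Fin n) → degree K x ≡ deg K x
degree≡deg K x = countᵇ≡count (adj K x)

-- a vertex is not its own neighbour, so deg K x < n
deg<n : ∀ {n} (K : Graph n) (x : Fin n) → deg K x + 1 ≤ n
deg<n K x = subst (deg K x + 1 ≤_) (count-complement (adj K x))
  (+-monoʳ-≤ (deg K x) (≤-trans (≤-reflexive (cong (𝟙 ∘ not) (sym (adj-irrefl K x))))
    (term≤sum (λ y → 𝟙 (not (adj K x y))) x)))

-- double counting of the K-edges with an endpoint in Q
degIn-sum : ∀ {n} (K : Graph n) (Q : Fin n → Bool) →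
  sum (λ x → degIn K x Q) ≡ sum (λ y → 𝟙 (Q y) * deg K y)
degIn-sum K Q = begin
  sum (λ x → sum (λ y → 𝟙 (adj K x y ∧ Q y)))   ≡⟨ ∑-comm (λ x y → 𝟙 (adj K x y ∧ Q y)) ⟩
  sum (λ y → sum (λ x → 𝟙 (adj K x y ∧ Q y)))   ≡⟨ sum-cong-≗ (λ y → sum-cong-≗ (flip y)) ⟩
  sum (λ y → sum (λ x → 𝟙 (Q y) * 𝟙 (adj K y x))) ≡⟨ sum-cong-≗ (λ y → sym (*-distribˡ-sum (𝟙 (Q y)) (𝟙 ∘ adj K y))) ⟩
  sum (λ y → 𝟙 (Q y) * deg K y)                  ∎
  where
  open ≡-Reasoning
  flip : ∀ y x → 𝟙 (adj K x y ∧ Q y) ≡ 𝟙 (Q y) * 𝟙 (adj K y x)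
  flip y x = trans (cong 𝟙 (trans (∧-comm (adj K x y) (Q y)) (cong (Q y ∧_) (adj-sym K x y))))
                   (𝟙-∧ (Q y) (adj K y x))

handshake : ∀ {n} (h : Fin n → Fin n → ℕ) → (∀ x y → h x y ≡ h y x) → (∀ x → h x x ≡ 0) →
  2 ∣ sum (λ x → sum (h x))
handshake {zero}  h symm diag = divides 0 refl
handshake {suc n} h symm diag =
  subst (2 ∣_) (sym split) (∣m∣n⇒∣m+n (divides A (double A)) inner)
  where
  open ≡-Reasoning
  A : ℕ
  A = sum (λ y → h zero (suc y))
  double : ∀ a → a + a ≡ a * 2
  double = solve-∀
  R : ℕ
  R = sum (λ x → sum (λ y → h (suc x) (suc y)))
  inner : 2 ∣ R
  inner = handshake (λ x y → h (suc x) (suc y)) (λ x y → symm (suc x) (suc y)) (diag ∘ suc)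
  split : sum (λ x → sum (h x)) ≡ (A + A) + R
  split = begin
    h zero zero + A + sum (λ x → h (suc x) zero + sum (λ y → h (suc x) (suc y)))
      ≡⟨ cong₂ (λ d r → d + A + r) (diag zero)
               (∑-distrib-+ (λ x → h (suc x) zero) (λ x → sum (λ y → h (suc x) (suc y)))) ⟩
    A + (sum (λ x → h (suc x) zero) + R) ≡⟨ cong (λ c → A + (c + R)) (sum-cong-≗ (λ x → symm (suc x) zero)) ⟩
    A + (A + R)                          ≡⟨ +-assoc A A R ⟨
    A + A + R                            ∎

degree-sum-even : ∀ {n} (G : Graph n) → 2 ∣ sum (deg G)
degree-sum-even G = handshake (λ x y → 𝟙 (adj G x y)) (λ x y → cong 𝟙 (adj-sym G x y)) (λ x → cong 𝟙 (adj-irrefl G x))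

∅ᴳ : ∀ {n} → Graph n
∅ᴳ = record { adj = λ _ _ → false ; adj-sym = λ _ _ → refl ; adj-irrefl = λ _ → refl }

∅⊆ : ∀ {n} (H : Graph n) → ∅ᴳ ⊆ᴳ H
∅⊆ H x y ()

deg-∅ : ∀ {n} (x : Fin n) → deg ∅ᴳ x ≡ 0
deg-∅ {n} x = count-none {n} (λ _ → false) (λ _ → refl)

adjacent⇒≢ : ∀ {n} (H : Graph n) {x y : Fin n} → adj H x y ≡ true → x ≢ y
adjacent⇒≢ H {x} hxy refl = contradiction (trans (sym hxy) (adj-irrefl H x)) λ ()

edge : ∀ {n} (u v : Fin n) → u ≢ v → Graph n
edge u v u≢v = record
  { adj        = λ x y → (x == u ∧ y == v) ∨ (x == v ∧ y == u)
  ; adj-sym    = λ x y → trans (∨-comm (x == u ∧ y == v) (x == v ∧ y == u))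
                                (cong₂ _∨_ (∧-comm (x == v) (y == u)) (∧-comm (x == u) (y == v)))
  ; adj-irrefl = λ x → cong₂ _∨_ (==-∧-distinct x u≢v) (==-∧-distinct x (u≢v ∘ sym))
  }

edge-ends : ∀ {n} {u v : Fin n} (u≢v : u ≢ v) {a b : Fin n} → adj (edge u v u≢v) a b ≡ true →
  (a ≡ u × b ≡ v) ⊎ (a ≡ v × b ≡ u)
edge-ends {u = u} {v} u≢v {a} {b} e with (a == u ∧ b == v) in p
... | true  = inj₁ (==⇒≡ (proj₁ (∧-true (a == u) p)) , ==⇒≡ (proj₂ (∧-true (a == u) p)))
... | false = inj₂ (==⇒≡ (proj₁ (∧-true (a == v) e)) , ==⇒≡ (proj₂ (∧-true (a == v) e)))

-- the degree increment caused by adding the edge uv (or two edges at u when u = v)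
incr : ∀ {n} → Fin n → Fin n → Fin n → ℕ
incr u v z = 𝟙 (z == u) + 𝟙 (z == v)

sum-incr : ∀ {n} (u v : Fin n) → sum (incr u v) ≡ 2
sum-incr u v = trans (∑-distrib-+ (λ z → 𝟙 (z == u)) (λ z → 𝟙 (z == v))) (cong₂ _+_ (count-== u) (count-== v))

deg-edge : ∀ {n} (u v : Fin n) (u≢v : u ≢ v) (x : Fin n) → deg (edge u v u≢v) x ≡ incr u v x
deg-edge u v u≢v x = begin
  count (λ y → (x == u ∧ y == v) ∨ (x == v ∧ y == u))
    ≡⟨ sum-cong-≗ (λ y → 𝟙-split (x == u) (y == v) (x == v) (y == u) (==-∧-distinct x u≢v)) ⟩
  sum (λ y → 𝟙 (x == u) * 𝟙 (y == v) + 𝟙 (x == v) * 𝟙 (y == u))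
    ≡⟨ ∑-distrib-+ (λ y → 𝟙 (x == u) * 𝟙 (y == v)) (λ y → 𝟙 (x == v) * 𝟙 (y == u)) ⟩
  sum (λ y → 𝟙 (x == u) * 𝟙 (y == v)) + sum (λ y → 𝟙 (x == v) * 𝟙 (y == u))
    ≡⟨ cong₂ _+_ (*-distribˡ-sum (𝟙 (x == u)) (λ y → 𝟙 (y == v))) (*-distribˡ-sum (𝟙 (x == v)) (λ y → 𝟙 (y == u))) ⟨
  𝟙 (x == u) * count (_== v) + 𝟙 (x == v) * count (_== u)
    ≡⟨ cong₂ (λ a b → 𝟙 (x == u) * a + 𝟙 (x == v) * b) (count-== v) (count-== u) ⟩
  𝟙 (x == u) * 1 + 𝟙 (x == v) * 1
    ≡⟨ cong₂ _+_ (*-identityʳ (𝟙 (x == u))) (*-identityʳ (𝟙 (x == v))) ⟩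
  incr u v x ∎
  where
  open ≡-Reasoning
  -- the two orientations of the edge are exclusive at a fixed x
  𝟙-split : ∀ a b c d → (a ∧ c) ≡ false → 𝟙 ((a ∧ b) ∨ (c ∧ d)) ≡ 𝟙 a * 𝟙 b + 𝟙 c * 𝟙 d
  𝟙-split false b c d _ = 𝟙-∧ c d
  𝟙-split true  false false d _ = refl
  𝟙-split true  true  false d _ = refl
  𝟙-split true  false true d ()
  𝟙-split true  true  true d ()

_∪ᴳ_ : ∀ {n} → Graph n → Graph n → Graph n
K ∪ᴳ L = record
  { adj        = λ x y → adj K x y ∨ adj L x y
  ; adj-sym    = λ x y → cong₂ _∨_ (adj-sym K x y) (adj-sym L x y)
  ; adj-irrefl = λ x → cong₂ _∨_ (adj-irrefl K x) (adj-irrefl L x)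
  }

EdgeDisjoint : ∀ {n} → Graph n → Graph n → Set
EdgeDisjoint K L = ∀ x y → (adj K x y ∧ adj L x y) ≡ false

deg-∪ : ∀ {n} (K L : Graph n) → EdgeDisjoint K L → ∀ x → deg (K ∪ᴳ L) x ≡ deg K x + deg L x
deg-∪ K L disj x = trans (sum-cong-≗ (λ y → 𝟙-∨ (adj K x y) (adj L x y) (disj x y)))
                         (∑-distrib-+ (𝟙 ∘ adj K x) (𝟙 ∘ adj L x))
  where
  𝟙-∨ : ∀ a b → (a ∧ b) ≡ false → 𝟙 (a ∨ b) ≡ 𝟙 a + 𝟙 b
  𝟙-∨ false b     _ = refl
  𝟙-∨ true  false _ = refl
  𝟙-∨ true  true  ()

deg-─ : ∀ {n} (K L : Graph n) → L ⊆ᴳ K → ∀ x → deg (K ─ᴱ L) x + deg L x ≡ deg K x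
deg-─ K L L⊆K x = trans (sym (∑-distrib-+ (λ y → 𝟙 (adj K x y ∧ not (adj L x y))) (𝟙 ∘ adj L x)))
                        (sum-cong-≗ (λ y → 𝟙-sub (adj K x y) (adj L x y) (L⊆K x y)))
  where
  𝟙-sub : ∀ a b → (b ≡ true → a ≡ true) → 𝟙 (a ∧ not b) + 𝟙 b ≡ 𝟙 a
  𝟙-sub false false _ = refl
  𝟙-sub true  false _ = refl
  𝟙-sub a     true  b⇒a rewrite b⇒a refl = refl

edge⊆ : ∀ {n} (H : Graph n) {u v : Fin n} (u≢v : u ≢ v) → adj H u v ≡ true → edge u v u≢v ⊆ᴳ H
edge⊆ H u≢v huv a b e with edge-ends u≢v {a} {b} e
... | inj₁ (refl , refl) = huv
... | inj₂ (refl , refl) = trans (adj-sym H a b) huv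

∪⊆ : ∀ {n} (K L : Graph n) {H : Graph n} → K ⊆ᴳ H → L ⊆ᴳ H → (K ∪ᴳ L) ⊆ᴳ H
∪⊆ K L K⊆H L⊆H a b h with adj K a b in p
... | true  = K⊆H a b p
... | false = L⊆H a b h

─⊆ : ∀ {n} (K L : Graph n) → (K ─ᴱ L) ⊆ᴳ K
─⊆ K L a b h = proj₁ (∧-true (adj K a b) h)

edge-disjoint : ∀ {n} (K : Graph n) {u v : Fin n} (u≢v : u ≢ v) → adj K u v ≡ false →
  EdgeDisjoint K (edge u v u≢v)
edge-disjoint K {u} {v} u≢v kuv a b with adj (edge u v u≢v) a b in e
... | false = Bool.∧-zeroʳ (adj K a b)
... | true with edge-ends u≢v {a} {b} e
...   | inj₁ (refl , refl) rewrite kuv = refl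
...   | inj₂ (refl , refl) rewrite adj-sym K a b | kuv = refl

-- To build K ⊆ H with prescribed degrees f we start from the
-- empty graph and repeatedly replace K by some K' ⊆ H whose degrees still lie
-- below f and whose degree sum is larger by two.  Each step raises the degree
-- by one at two vertices u, v (by two at u if u = v), either by adding an
-- edge or by switching along a path u – x = y – v.

Fits : ∀ {n} → (Fin n → ℕ) → (Fin n → ℕ) → Fin n → Fin n → Set
Fits g f u v = ∀ z → g z + incr u v z ≤ f z

fits-distinct : ∀ {n} {g f : Fin n → ℕ} {u v : Fin n} → u ≢ v →
  g u < f u → g v < f v → (∀ z → g z ≤ f z) → Fits g f u v
fits-distinct {g = g} {f} {u} {v} u≢v gu<fu gv<fv g≤f z with z ≟ u | z ≟ v
... | yes refl | yes refl = contradiction refl u≢v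
... | yes refl | no  _    = subst (_≤ f z) (+-comm 1 (g z)) gu<fu
... | no  _    | yes refl = subst (_≤ f z) (+-comm 1 (g z)) gv<fv
... | no  _    | no  _    = subst (_≤ f z) (sym (+-identityʳ (g z))) (g≤f z)

fits-twice : ∀ {n} {g f : Fin n → ℕ} {u : Fin n} → g u + 2 ≤ f u → (∀ z → g z ≤ f z) → Fits g f u u
fits-twice {g = g} {f} {u} gu+2≤fu g≤f z with z ≟ u
... | yes refl = gu+2≤fu
... | no  _    = subst (_≤ f z) (sym (+-identityʳ (g z))) (g≤f z)

incr-atˡ : ∀ {n} (u v : Fin n) → 1 ≤ incr u v u
incr-atˡ u v = subst (λ b → 1 ≤ 𝟙 b + 𝟙 (u == v)) (sym (==-refl u)) (s≤s z≤n)

incr-atʳ : ∀ {n} (u v : Fin n) → 1 ≤ incr u v v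
incr-atʳ u v = subst (λ b → 1 ≤ 𝟙 (v == u) + 𝟙 b) (sym (==-refl v)) (m≤n+m 1 _)

fits⇒deficientˡ : ∀ {n} {g f : Fin n → ℕ} {u v : Fin n} → Fits g f u v → g u < f u
fits⇒deficientˡ {g = g} {u = u} {v} fits =
  ≤-trans (≤-reflexive (+-comm 1 (g u))) (≤-trans (+-monoʳ-≤ (g u) (incr-atˡ u v)) (fits u))

fits⇒deficientʳ : ∀ {n} {g f : Fin n → ℕ} {u v : Fin n} → Fits g f u v → g v < f v
fits⇒deficientʳ {g = g} {u = u} {v} fits =
  ≤-trans (≤-reflexive (+-comm 1 (g v))) (≤-trans (+-monoʳ-≤ (g v) (incr-atʳ u v)) (fits v))

fits⇒gap : ∀ {n} {g f : Fin n → ℕ} {u v : Fin n} → Fits g f u v → sum g + 2 ≤ sum f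
fits⇒gap {g = g} {f} {u} {v} fits = begin
  sum g + 2                      ≡⟨ cong (sum g +_) (sum-incr u v) ⟨
  sum g + sum (incr u v)         ≡⟨ ∑-distrib-+ g (incr u v) ⟨
  sum (λ z → g z + incr u v z)   ≤⟨ sum-mono-≤ fits ⟩
  sum f                          ∎
  where open ≤-Reasoning

deficient-pair : ∀ {n} (g f : Fin n → ℕ) → (∀ z → g z ≤ f z) → sum g + 2 ≤ sum f →
  ∃₂ λ u v → Fits g f u v
deficient-pair g f g≤f gap with sum-<⇒∃ g f (<-≤-trans (m<m+n (sum g) (s≤s z≤n)) gap)
... | u , gu<fu with search (λ z → (g z <ᵇ f z) ∧ not (z == u))
...   | inj₁ (v , hv) =
  let (gv<fv , v≠u) = ∧-true (g v <ᵇ f v) hv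
  in u , v , fits-distinct (≢-sym (==false⇒≢ (not-true v≠u))) gu<fu (<ᵇ-true gv<fv) g≤f
...   | inj₂ none = u , u , fits-twice (+-cancelˡ-≤ (sum g) _ _ gu+2≤fu) g≤f
  where
  open ≤-Reasoning
  tight : ∀ z → z ≢ u → g z ≡ f z
  tight z z≢u with g z <ᵇ f z in p
  ... | false = ≤-antisym (g≤f z) (<ᵇ-false p)
  ... | true  = contradiction (trans (sym (none z)) (cong₂ (λ a b → a ∧ not b) p (≢⇒==false z≢u))) λ ()
  gu+2≤fu : sum g + (g u + 2) ≤ sum g + f u
  gu+2≤fu = begin
    sum g + (g u + 2) ≡⟨ cong (sum g +_) (+-comm (g u) 2) ⟩
    sum g + (2 + g u) ≡⟨ +-assoc (sum g) 2 (g u) ⟨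
    sum g + 2 + g u   ≤⟨ +-monoˡ-≤ (g u) gap ⟩
    sum f + g u       ≡⟨ sum-agree-off g f u tight ⟨
    sum g + f u       ∎

Improves : ∀ {n} → (Fin n → ℕ) → Graph n → Graph n → Set
Improves f K K' = (∀ z → deg K' z ≤ f z) × (sum (deg K') ≡ sum (deg K) + 2)

improves : ∀ {n} {f : Fin n → ℕ} (K K' : Graph n) {u v : Fin n} →
  (∀ z → deg K' z ≡ deg K z + incr u v z) → Fits (deg K) f u v → Improves f K K'
improves K K' {u} {v} deg' fits =
    (λ z → subst (_≤ _) (sym (deg' z)) (fits z))
  , trans (sum-cong-≗ deg') (trans (∑-distrib-+ (deg K) (incr u v)) (cong (sum (deg K) +_) (sum-incr u v)))

augment-add : ∀ {n} (H K : Graph n) {f : Fin n → ℕ} {u x : Fin n} → K ⊆ᴳ H →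
  adj H u x ≡ true → adj K u x ≡ false → Fits (deg K) f u x →
  ∃ λ K' → K' ⊆ᴳ H × Improves f K K'
augment-add H K {u = u} {x} K⊆H hux kux fits =
  K ∪ᴳ edge u x u≢x , ∪⊆ K (edge u x u≢x) {H} K⊆H (edge⊆ H u≢x hux) ,
  improves K (K ∪ᴳ edge u x u≢x) deg' fits
  where
  u≢x = adjacent⇒≢ H hux
  deg' : ∀ z → deg (K ∪ᴳ edge u x u≢x) z ≡ deg K z + incr u x z
  deg' z = trans (deg-∪ K (edge u x u≢x) (edge-disjoint K u≢x kux) z) (cong (deg K z +_) (deg-edge u x u≢x z))

augment-switch : ∀ {n} (H K : Graph n) {f : Fin n → ℕ} {u v x y : Fin n} → K ⊆ᴳ H →
  adj K x y ≡ true → adj H u x ≡ true → adj H v y ≡ true →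
  adj K u x ≡ false → adj K v y ≡ false → x ≢ v → y ≢ u → Fits (deg K) f u v →
  ∃ λ K' → K' ⊆ᴳ H × Improves f K K'
augment-switch H K {u = u} {v} {x} {y} K⊆H kxy hux hvy kux kvy x≢v y≢u fits =
  K₂ , K₂⊆H , improves K K₂ deg' fits
  where
  x≢y = adjacent⇒≢ K kxy
  u≢x = adjacent⇒≢ H hux
  v≢y = adjacent⇒≢ H hvy
  K₀ = K ─ᴱ edge x y x≢y
  K₁ = K₀ ∪ᴳ edge u x u≢x
  K₂ = K₁ ∪ᴳ edge v y v≢y
  K₂⊆H : K₂ ⊆ᴳ H
  K₂⊆H = ∪⊆ K₁ (edge v y v≢y) {H}
           (∪⊆ K₀ (edge u x u≢x) {H} (λ a b h → K⊆H a b (─⊆ K (edge x y x≢y) a b h)) (edge⊆ H u≢x hux))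
           (edge⊆ H v≢y hvy)
  k₀ux : adj K₀ u x ≡ false
  k₀ux = cong (_∧ _) kux
  k₁vy : adj K₁ v y ≡ false
  k₁vy with adj (edge u x u≢x) v y in e
  ... | true with edge-ends u≢x {v} {y} e
  ...   | inj₁ (_ , y≡x) = contradiction (sym y≡x) x≢y
  ...   | inj₂ (v≡x , _) = contradiction (sym v≡x) x≢v
  k₁vy | false rewrite kvy = refl
  shuffle : ∀ a ux vy xy uv → ux + vy ≡ xy + uv → a + ux + vy ≡ a + xy + uv
  shuffle a ux vy xy uv eq = trans (+-assoc a ux vy) (trans (cong (a +_) eq) (sym (+-assoc a xy uv)))
  regroup : ∀ z → incr u x z + incr v y z ≡ incr x y z + incr u v z
  regroup z = solve4 (𝟙 (z == u)) (𝟙 (z == x)) (𝟙 (z == v)) (𝟙 (z == y))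
    where
    solve4 : ∀ a b c d → a + b + (c + d) ≡ b + d + (a + c)
    solve4 = solve-∀
  deg' : ∀ z → deg K₂ z ≡ deg K z + incr u v z
  deg' z = begin
    deg K₂ z
      ≡⟨ deg-∪ K₁ (edge v y v≢y) (edge-disjoint K₁ v≢y k₁vy) z ⟩
    deg K₁ z + deg (edge v y v≢y) z
      ≡⟨ cong₂ _+_ (deg-∪ K₀ (edge u x u≢x) (edge-disjoint K₀ u≢x k₀ux) z) (deg-edge v y v≢y z) ⟩
    deg K₀ z + deg (edge u x u≢x) z + incr v y z
      ≡⟨ cong (λ d → deg K₀ z + d + incr v y z) (deg-edge u x u≢x z) ⟩
    deg K₀ z + incr u x z + incr v y z
      ≡⟨ shuffle (deg K₀ z) _ _ _ _ (regroup z) ⟩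
    deg K₀ z + incr x y z + incr u v z
      ≡⟨ cong (λ d → deg K₀ z + d + incr u v z) (deg-edge x y x≢y z) ⟨
    deg K₀ z + deg (edge x y x≢y) z + incr u v z
      ≡⟨ cong (_+ incr u v z) (deg-─ K (edge x y x≢y) (edge⊆ K x≢y kxy) z) ⟩
    deg K z + incr u v z ∎
    where open ≡-Reasoning

AugmentingStep : ∀ {n} → Graph n → (Fin n → ℕ) → Set
AugmentingStep H f = ∀ K → K ⊆ᴳ H → (∀ z → deg K z ≤ f z) →
  ∀ u v → Fits (deg K) f u v → ∃ λ K' → K' ⊆ᴳ H × Improves f K K'

factor-by-augmentation : ∀ {n} (H : Graph n) (f : Fin n → ℕ) → AugmentingStep H f →
  2 ∣ sum f → ∃ λ K → K ⊆ᴳ H × (∀ z → deg K z ≡ f z)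
factor-by-augmentation {n} H f step (divides k Σf≡k*2) =
  grow k ∅ᴳ (∅⊆ H) (λ z → subst (_≤ f z) (sym (deg-∅ z)) z≤n)
       (trans Σf≡k*2 (cong (_+ k * 2) (sym Σdeg∅≡0)))
  where
  Σdeg∅≡0 : sum (deg {n} ∅ᴳ) ≡ 0
  Σdeg∅≡0 = trans (sum-cong-≗ {n} deg-∅) (trans (sum-const n 0) (*-zeroʳ n))
  grow : ∀ k K → K ⊆ᴳ H → (∀ z → deg K z ≤ f z) → sum f ≡ sum (deg K) + k * 2 →
    ∃ λ K → K ⊆ᴳ H × (∀ z → deg K z ≡ f z)
  grow zero    K K⊆H K≤f eq = K , K⊆H , sum-squeeze (deg K) f K≤f (≤-reflexive (trans eq (+-identityʳ _)))
  grow (suc k) K K⊆H K≤f eq =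
    let (u , v , fits) = deficient-pair (deg K) f K≤f gap
        (K' , K'⊆H , K'≤f , Σ-deg-K') = step K K⊆H K≤f u v fits
    in grow k K' K'⊆H K'≤f (trans eq' (cong (_+ k * 2) (sym Σ-deg-K')))
    where
    eq' : sum f ≡ sum (deg K) + 2 + k * 2
    eq' = trans eq (sym (+-assoc (sum (deg K)) 2 (k * 2)))
    gap : sum (deg K) + 2 ≤ sum f
    gap = subst (sum (deg K) + 2 ≤_) (sym eq') (m≤m+n _ _)

-- Augmentation step for K with deficient u, v: if u has a deficient
-- G-neighbour x outside K, add ux; otherwise a counting argument yields a
-- K-edge xy with ux, vy ∈ G ∖ K, and we switch along u – x = y – v.
module DenseFactor {n : ℕ} (G : Graph n) (t m s : ℕ) (f : Fin n → ℕ)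
  (dense : ∀ v → n ≤ deg G v + t) (f≤m : ∀ v → f v ≤ m)
  (few-zeros : count (λ v → f v ≡ᵇ 0) ≤ s) (large : s + (t + m) * (m + 2) ≤ n) where

  Blocked : Graph n → Fin n → Fin n → Bool
  Blocked K u x = not (adj G u x) ∨ adj K u x

  count-blocked : ∀ K u → count (Blocked K u) ≤ t + deg K u
  count-blocked K u = ≤-trans (count-∨ (not ∘ adj G u) (adj K u)) (+-monoˡ-≤ (deg K u) non-nbrs)
    where
    non-nbrs : count (not ∘ adj G u) ≤ t
    non-nbrs = +-cancelˡ-≤ (deg G u) _ _
      (subst (_≤ deg G u + t) (sym (count-complement (adj G u))) (dense u))

  Deficient : Graph n → Fin n → Bool
  Deficient K x = deg K x <ᵇ f x

  -- when every deficient vertex is blocked for u, a switch u – x = y – v exists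
  module Switch (K : Graph n) (K≤f : ∀ z → deg K z ≤ f z) (u v : Fin n) (fits : Fits (deg K) f u v)
    (stuck : ∀ x → Deficient K x ≡ true → Blocked K u x ≡ true) where

    u-deficient : deg K u < f u
    u-deficient = fits⇒deficientˡ {g = deg K} {f} {u} {v} fits
    v-deficient : deg K v < f v
    v-deficient = fits⇒deficientʳ {g = deg K} {f} {u} {v} fits

    -- forbidden positions for x (next to u) and for y (next to v)
    Xu : Fin n → Bool
    Xu x = x == v ∨ Blocked K u x
    Yv : Fin n → Bool
    Yv y = y == u ∨ Blocked K v y
    -- the remaining vertices, which carry at least one K-edge
    W : Fin n → Bool
    W x = not (Xu x) ∧ (not (Deficient K x) ∧ not (f x ≡ᵇ 0))

    count-forbidden : ∀ a b → deg K a < f a → count (λ x → x == b ∨ Blocked K a x) ≤ t + m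
    count-forbidden a b da = begin
      count (λ x → x == b ∨ Blocked K a x)      ≤⟨ count-∨ (_== b) (Blocked K a) ⟩
      count (_== b) + count (Blocked K a)      ≤⟨ +-mono-≤ (≤-reflexive (count-== b)) (count-blocked K a) ⟩
      1 + (t + deg K a)                        ≡⟨ +-suc t (deg K a) ⟨
      t + suc (deg K a)                        ≤⟨ +-monoʳ-≤ t (≤-trans da (f≤m a)) ⟩
      t + m                                    ∎
      where open ≤-Reasoning

    count-deficient : count (Deficient K) + 1 ≤ t + m
    count-deficient = begin
      count (Deficient K) + 1     ≤⟨ +-monoˡ-≤ 1 (count-mono (Deficient K) (Blocked K u) stuck) ⟩
      count (Blocked K u) + 1     ≤⟨ +-monoˡ-≤ 1 (count-blocked K u) ⟩
      t + deg K u + 1             ≡⟨ +-assoc t (deg K u) 1 ⟩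
      t + (deg K u + 1)           ≡⟨ cong (t +_) (+-comm (deg K u) 1) ⟩
      t + suc (deg K u)           ≤⟨ +-monoʳ-≤ t (≤-trans u-deficient (f≤m u)) ⟩
      t + m                       ∎
      where open ≤-Reasoning

    cover : n ≤ count W + count Xu + count (Deficient K) + count (λ x → f x ≡ᵇ 0)
    cover = begin
      n                 ≡⟨ trans (sym (*-identityʳ n)) (sym (sum-const n 1)) ⟩
      sum {n} (λ _ → 1) ≤⟨ sum-mono-≤ (λ x → one-of (Xu x) (Deficient K x) (f x ≡ᵇ 0)) ⟩
      sum (λ x → 𝟙 (W x) + 𝟙 (Xu x) + 𝟙 (Deficient K x) + 𝟙 (f x ≡ᵇ 0))
        ≡⟨ ∑-distrib-+ (λ x → 𝟙 (W x) + 𝟙 (Xu x) + 𝟙 (Deficient K x)) (λ x → 𝟙 (f x ≡ᵇ 0)) ⟩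
      sum (λ x → 𝟙 (W x) + 𝟙 (Xu x) + 𝟙 (Deficient K x)) + count (λ x → f x ≡ᵇ 0)
        ≡⟨ cong (_+ _) (∑-distrib-+ (λ x → 𝟙 (W x) + 𝟙 (Xu x)) (𝟙 ∘ Deficient K)) ⟩
      sum (λ x → 𝟙 (W x) + 𝟙 (Xu x)) + count (Deficient K) + count (λ x → f x ≡ᵇ 0)
        ≡⟨ cong (λ c → c + _ + _) (∑-distrib-+ (𝟙 ∘ W) (𝟙 ∘ Xu)) ⟩
      count W + count Xu + count (Deficient K) + count (λ x → f x ≡ᵇ 0) ∎
      where
      open ≤-Reasoning
      one-of : ∀ a b c → 1 ≤ 𝟙 (not a ∧ (not b ∧ not c)) + 𝟙 a + 𝟙 b + 𝟙 c
      one-of false false false = s≤s z≤n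
      one-of false false true  = s≤s z≤n
      one-of false true  c     = s≤s z≤n
      one-of true  b     c     = s≤s z≤n

    module _ (no-switch : ∀ x y → (adj K x y ∧ (not (Xu x) ∧ not (Yv y))) ≡ false) where

      -- a vertex of W has all its K-neighbours in Yv, and at least one of them
      W-edges : ∀ x → 𝟙 (W x) ≤ degIn K x Yv
      W-edges x with W x in wx
      ... | false = z≤n
      ... | true  = begin
        1                                                        ≤⟨ f-pos ⟩
        f x                                                      ≤⟨ <ᵇ-false (not-true (proj₁ (∧-true (not (Deficient K x)) rest))) ⟩
        deg K x                                                  ≡⟨ count-split (adj K x) Yv ⟨
        degIn K x Yv + count (λ y → adj K x y ∧ not (Yv y))      ≡⟨ cong (degIn K x Yv +_) (count-none _ none-outside) ⟩
        degIn K x Yv + 0                                         ≡⟨ +-identityʳ _ ⟩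
        degIn K x Yv                                             ∎
        where
        open ≤-Reasoning
        x-free = not-true (proj₁ (∧-true (not (Xu x)) wx))
        rest = proj₂ (∧-true (not (Xu x)) wx)
        f-pos : 1 ≤ f x
        f-pos with f x | not-true (proj₂ (∧-true (not (Deficient K x)) rest))
        ... | suc _ | _  = s≤s z≤n
        ... | zero  | ()
        none-outside : ∀ y → (adj K x y ∧ not (Yv y)) ≡ false
        none-outside y = subst (λ b → (adj K x y ∧ (not b ∧ not (Yv y))) ≡ false) x-free (no-switch x y)

      count-W : count W ≤ (t + m) * m
      count-W = begin
        count W                          ≤⟨ sum-mono-≤ W-edges ⟩
        sum (λ x → degIn K x Yv)         ≡⟨ degIn-sum K Yv ⟩
        sum (λ y → 𝟙 (Yv y) * deg K y)   ≤⟨ sum-mono-≤ (λ y → *-monoʳ-≤ (𝟙 (Yv y)) (≤-trans (K≤f y) (f≤m y))) ⟩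
        sum (λ y → 𝟙 (Yv y) * m)         ≡⟨ *-distribʳ-sum m (𝟙 ∘ Yv) ⟨
        count Yv * m                     ≤⟨ *-monoˡ-≤ m (count-forbidden v u v-deficient) ⟩
        (t + m) * m                      ∎
        where open ≤-Reasoning

      impossible : ⊥
      impossible = <-irrefl refl (<-≤-trans n<n large)
        where
        open ≤-Reasoning
        c = count (Deficient K)
        z = count (λ x → f x ≡ᵇ 0)
        shift : ∀ a b c z → a + b + c + z < a + b + (c + 1) + z
        shift a b c z = ≤-reflexive (solve₄ a b c z)
          where
          solve₄ : ∀ a b c z → suc (a + b + c + z) ≡ a + b + (c + 1) + z
          solve₄ = solve-∀
        collect : ∀ k m z → k * m + k + k + z ≡ z + k * (m + 2)
        collect = solve-∀
        n<n : n < s + (t + m) * (m + 2)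
        n<n = begin-strict
          n                                         ≤⟨ cover ⟩
          count W + count Xu + c + z                <⟨ shift (count W) (count Xu) c z ⟩
          count W + count Xu + (c + 1) + z
            ≤⟨ +-mono-≤ (+-mono-≤ (+-mono-≤ count-W (count-forbidden u v u-deficient)) count-deficient) few-zeros ⟩
          (t + m) * m + (t + m) + (t + m) + s       ≡⟨ collect (t + m) m s ⟩
          s + (t + m) * (m + 2)                     ∎

    switch-pair : ∃₂ λ x y → adj K x y ≡ true × Xu x ≡ false × Yv y ≡ false
    switch-pair with search₂ (λ x y → adj K x y ∧ (not (Xu x) ∧ not (Yv y)))
    ... | inj₁ (x , y , h) =
      let (kxy , free) = ∧-true (adj K x y) h in
      x , y , kxy , not-true (proj₁ (∧-true (not (Xu x)) free)) , not-true (proj₂ (∧-true (not (Xu x)) free))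
    ... | inj₂ none = ⊥-elim (impossible none)

  augmenting-step : AugmentingStep G f
  augmenting-step K K⊆G K≤f u v fits with search (λ x → Deficient K x ∧ not (Blocked K u x))
  ... | inj₁ (x , h) =
    let (dx , free) = ∧-true (Deficient K x) h
        (gux , kux) = ∨-false (not (adj G u x)) (not-true free)
        u-deficient = fits⇒deficientˡ {g = deg K} {f} {u} {v} fits
    in augment-add G K K⊆G (not-false gux) kux
         (fits-distinct (adjacent⇒≢ G (not-false gux)) u-deficient (<ᵇ-true dx) K≤f)
  ... | inj₂ none =
    let (x , y , kxy , x-free , y-free) = Switch.switch-pair K K≤f u v fits stuck
        (x≠v , x-unblocked) = ∨-false (x == v) x-free
        (gux , kux) = ∨-false (not (adj G u x)) x-unblocked
        (y≠u , y-unblocked) = ∨-false (y == u) y-free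
        (gvy , kvy) = ∨-false (not (adj G v y)) y-unblocked
    in augment-switch G K K⊆G kxy (not-false gux) (not-false gvy) kux kvy (==false⇒≢ x≠v) (==false⇒≢ y≠u) fits
    where
    stuck : ∀ x → Deficient K x ≡ true → Blocked K u x ≡ true
    stuck x dx = not-false (subst (λ d → (d ∧ not (Blocked K u x)) ≡ false) dx (none x))

  dense-factor : 2 ∣ sum f → ∃ λ K → K ⊆ᴳ G × (∀ z → deg K z ≡ f z)
  dense-factor = factor-by-augmentation G f augmenting-step

-- Augmentation step for unmatched u ≠ v in A: join u or v to an unmatched
-- A-neighbour if possible; otherwise some matched A-neighbour x of u has its
-- partner y among the A-neighbours of v (else |A| ≥ 2d + 2), and we switch
-- along u – x = y – v.
module DenseMatching {n : ℕ} (H : Graph n) (A : Fin n → Bool) (d : ℕ)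
  (min-deg : ∀ x → A x ≡ true → d ≤ degIn H x A) (small : count A ≤ d + d + 1) where

  Unmatched : Graph n → Fin n → Bool
  Unmatched M x = deg M x <ᵇ 𝟙 (A x)

  below-𝟙 : ∀ {a} b → a < 𝟙 b → a ≡ 0 × b ≡ true
  below-𝟙 {zero}  true _         = refl , refl
  below-𝟙 {suc a} true (s≤s ())

  module Step (M : Graph n) (M⊆H : M ⊆ᴳ H) (M≤A : ∀ z → deg M z ≤ 𝟙 (A z)) (u v : Fin n)
    (fits : Fits (deg M) (𝟙 ∘ A) u v) where

    u-unmatched : deg M u < 𝟙 (A u)
    u-unmatched = fits⇒deficientˡ {g = deg M} {𝟙 ∘ A} {u} {v} fits
    v-unmatched : deg M v < 𝟙 (A v)
    v-unmatched = fits⇒deficientʳ {g = deg M} {𝟙 ∘ A} {u} {v} fits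

    u-in-A : A u ≡ true
    u-in-A = proj₂ (below-𝟙 (A u) u-unmatched)
    v-in-A : A v ≡ true
    v-in-A = proj₂ (below-𝟙 (A v) v-unmatched)

    isolated : ∀ {a} → deg M a < 𝟙 (A a) → ∀ b → adj M a b ≡ false
    isolated {a} a-unmatched = count-zero (adj M a) (proj₁ (below-𝟙 (A a) a-unmatched))

    Q : Fin n → Bool
    Q y = adj H v y ∧ A y

    matched : ∀ a → (∀ x → (Unmatched M x ∧ adj H a x) ≡ false) → ∀ x → (adj H a x ∧ A x) ≡ true → 1 ≤ deg M x
    matched a none x h with Unmatched M x in p
    ... | true  = contradiction (trans (sym (none x)) (cong₂ _∧_ p (proj₁ (∧-true (adj H a x) h)))) λ ()
    ... | false = subst (_≤ deg M x) (cong 𝟙 (proj₂ (∧-true (adj H a x) h))) (<ᵇ-false p)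

    -- with no direct edge and no switch available, the A-neighbourhoods of u
    -- and v are matched into disjoint sets, so 2d + 2 ≤ |A|
    module _ (none-u : ∀ x → (Unmatched M x ∧ adj H u x) ≡ false)
             (none-v : ∀ y → (Unmatched M y ∧ adj H v y) ≡ false)
             (no-switch : ∀ x y → (adj H u x ∧ (adj M x y ∧ Q y)) ≡ false) where

      P-or-Q : ∀ x → 𝟙 (adj H u x ∧ A x) + degIn M x Q ≤ deg M x
      P-or-Q x with adj H u x ∧ A x in p
      ... | false = count-mono (λ y → adj M x y ∧ Q y) (adj M x) (λ y h → proj₁ (∧-true (adj M x y) h))
      ... | true  = subst (λ c → suc c ≤ deg M x) (sym (count-none (λ y → adj M x y ∧ Q y) none-x))
                      (matched u none-u x p)
        where
        none-x : ∀ y → (adj M x y ∧ Q y) ≡ false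
        none-x y = subst (λ b → (b ∧ (adj M x y ∧ Q y)) ≡ false) (proj₁ (∧-true (adj H u x) p)) (no-switch x y)

      Q-matched : ∀ y → 𝟙 (Q y) ≤ 𝟙 (Q y) * deg M y
      Q-matched y with Q y in q
      ... | false = z≤n
      ... | true  = subst (1 ≤_) (sym (+-identityʳ (deg M y))) (matched v none-v y q)

      neighbourhoods : degIn H u A + degIn H v A ≤ sum (deg M)
      neighbourhoods = begin
        degIn H u A + count Q                             ≤⟨ +-monoʳ-≤ (degIn H u A) (sum-mono-≤ Q-matched) ⟩
        degIn H u A + sum (λ y → 𝟙 (Q y) * deg M y)       ≡⟨ cong (degIn H u A +_) (degIn-sum M Q) ⟨
        degIn H u A + sum (λ x → degIn M x Q)             ≡⟨ ∑-distrib-+ (λ x → 𝟙 (adj H u x ∧ A x)) (λ x → degIn M x Q) ⟨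
        sum (λ x → 𝟙 (adj H u x ∧ A x) + degIn M x Q)     ≤⟨ sum-mono-≤ P-or-Q ⟩
        sum (deg M)                                       ∎
        where open ≤-Reasoning

      impossible : ⊥
      impossible = <-irrefl refl (subst (_≤ d + d + 1) (+-suc (d + d) 1) (begin
        d + d + 2                          ≤⟨ +-monoˡ-≤ 2 (+-mono-≤ (min-deg u u-in-A) (min-deg v v-in-A)) ⟩
        degIn H u A + degIn H v A + 2      ≤⟨ +-monoˡ-≤ 2 neighbourhoods ⟩
        sum (deg M) + 2                    ≤⟨ fits⇒gap {g = deg M} {𝟙 ∘ A} {u} {v} fits ⟩
        count A                            ≤⟨ small ⟩
        d + d + 1                          ∎))
        where open ≤-Reasoning

    improve : ∃ λ M' → M' ⊆ᴳ H × Improves (𝟙 ∘ A) M M'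
    improve with search (λ x → Unmatched M x ∧ adj H u x) | search (λ y → Unmatched M y ∧ adj H v y)
               | search₂ (λ x y → adj H u x ∧ (adj M x y ∧ Q y))
    ... | inj₁ (x , h) | _ | _ =
      let (x-unmatched , hux) = ∧-true (Unmatched M x) h
      in augment-add H M M⊆H hux (isolated u-unmatched x)
           (fits-distinct (adjacent⇒≢ H hux) u-unmatched (<ᵇ-true x-unmatched) M≤A)
    ... | inj₂ _ | inj₁ (y , h) | _ =
      let (y-unmatched , hvy) = ∧-true (Unmatched M y) h
      in augment-add H M M⊆H hvy (isolated v-unmatched y)
           (fits-distinct (adjacent⇒≢ H hvy) v-unmatched (<ᵇ-true y-unmatched) M≤A)
    ... | inj₂ _ | inj₂ _ | inj₁ (x , y , h) =
      let (hux , rest) = ∧-true (adj H u x) h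
          (mxy , qy) = ∧-true (adj M x y) rest
      in augment-switch H M M⊆H mxy hux (proj₁ (∧-true (adj H v y) qy))
           (isolated u-unmatched x) (isolated v-unmatched y)
           (λ { refl → contradiction (trans (sym (isolated v-unmatched y)) mxy) λ () })
           (λ { refl → contradiction (trans (sym (isolated u-unmatched x)) (trans (adj-sym M y x) mxy)) λ () })
           fits
    ... | inj₂ none-u | inj₂ none-v | inj₂ no-switch = ⊥-elim (impossible none-u none-v no-switch)

  augmenting-step : AugmentingStep H (𝟙 ∘ A)
  augmenting-step M M⊆H M≤A u v fits = Step.improve M M⊆H M≤A u v fits

  dense-matching : 2 ∣ count A → ∃ λ M → M ⊆ᴳ H × (∀ z → deg M z ≡ 𝟙 (A z))
  dense-matching = factor-by-augmentation H (𝟙 ∘ A) augmenting-step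

regular-remainder : ∀ {n} (G K : Graph n) {r : ℕ} → K ⊆ᴳ G → (∀ v → deg K v + r ≡ deg G v) →
  IsRegular r (G ─ᴱ K)
regular-remainder G K {r} K⊆G deg-K v = trans (degree≡deg (G ─ᴱ K) v) (+-cancelˡ-≡ (deg K v) _ _ (begin
  deg K v + deg (G ─ᴱ K) v ≡⟨ +-comm (deg K v) _ ⟩
  deg (G ─ᴱ K) v + deg K v ≡⟨ deg-─ G K K⊆G v ⟩
  deg G v                  ≡⟨ deg-K v ⟨
  deg K v + r              ∎))
  where open ≡-Reasoning

-- A perfect matching M of A in H (dense
-- matching lemma) is an optimal matching of G, and H − M is a (δ − 1)-factor
-- of G − M.
matching-with-factor : ∀ {n} (G H : Graph n) (A : Fin n → Bool) (δ : ℕ) → H ⊆ᴳ G →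
  (∀ z → deg H z + 𝟙 (not (A z)) ≡ δ) → count (not ∘ A) ≤ 1 → 2 ∣ count A → n + 1 ≤ δ + δ →
  ∃ λ M → IsOptimalMatching G M × HasFactor (δ ∸ 1) (G ─ᴱ M)
matching-with-factor {n} G H A δ H⊆G deg-H few-outside A-even n<2δ =
    M , ((M⊆G , M-deg≤1) , M-uncovered)
  , H ─ᴱ M , F⊆G─M , F-regular
  where
  open ≤-Reasoning
  min-deg : ∀ x → A x ≡ true → δ ∸ 1 ≤ degIn H x A
  min-deg x ax = ≤-trans (∸-monoˡ-≤ 1 δ≤) (≤-reflexive (m+n∸n≡m _ 1))
    where
    outside-nbrs : count (λ y → adj H x y ∧ not (A y)) ≤ 1
    outside-nbrs = ≤-trans (count-mono (λ y → adj H x y ∧ not (A y)) (not ∘ A) (λ y h → proj₂ (∧-true (adj H x y) h)))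
                           few-outside
    δ≤ : δ ≤ degIn H x A + 1
    δ≤ = begin
      δ                                                  ≡⟨ deg-H x ⟨
      deg H x + 𝟙 (not (A x))                            ≡⟨ cong (λ b → deg H x + 𝟙 (not b)) ax ⟩
      deg H x + 0                                        ≡⟨ +-identityʳ _ ⟩
      deg H x                                            ≡⟨ count-split (adj H x) A ⟨
      degIn H x A + count (λ y → adj H x y ∧ not (A y))  ≤⟨ +-monoʳ-≤ (degIn H x A) outside-nbrs ⟩
      degIn H x A + 1                                    ∎
  A-small : count A ≤ (δ ∸ 1) + (δ ∸ 1) + 1
  A-small = ≤-trans (count≤n A) (halve δ n<2δ)
    where
    halve : ∀ δ → n + 1 ≤ δ + δ → n ≤ (δ ∸ 1) + (δ ∸ 1) + 1
    halve zero    le = contradiction (≤-trans (m≤n+m 1 n) le) λ ()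
    halve (suc δ) le = +-cancelʳ-≤ 1 n (δ + δ + 1) (subst (n + 1 ≤_) (double-suc δ) le)
      where
      double-suc : ∀ d → suc d + suc d ≡ d + d + 1 + 1
      double-suc = solve-∀
  matching = DenseMatching.dense-matching H A (δ ∸ 1) min-deg A-small A-even
  M = proj₁ matching
  M⊆H = proj₁ (proj₂ matching)
  deg-M = proj₂ (proj₂ matching)
  M⊆G : M ⊆ᴳ G
  M⊆G a b h = H⊆G a b (M⊆H a b h)
  M-deg≤1 : ∀ v → degree M v ≤ 1
  M-deg≤1 v = subst (_≤ 1) (sym (trans (degree≡deg M v) (deg-M v))) (𝟙≤1 (A v))
    where
    𝟙≤1 : ∀ b → 𝟙 b ≤ 1
    𝟙≤1 false = z≤n
    𝟙≤1 true  = s≤s z≤n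
  M-uncovered : countᵇ (λ v → degree M v ≡ᵇ 0) ≤ 1
  M-uncovered = ≤-trans (≤-reflexive (trans (countᵇ≡count (λ v → degree M v ≡ᵇ 0)) (sum-cong-≗ uncovered))) few-outside
    where
    𝟙≡ᵇ0 : ∀ b → (𝟙 b ≡ᵇ 0) ≡ not b
    𝟙≡ᵇ0 false = refl
    𝟙≡ᵇ0 true  = refl
    uncovered : ∀ v → 𝟙 (degree M v ≡ᵇ 0) ≡ 𝟙 (not (A v))
    uncovered v = cong 𝟙 (trans (cong (_≡ᵇ 0) (trans (degree≡deg M v) (deg-M v))) (𝟙≡ᵇ0 (A v)))
  F⊆G─M : (H ─ᴱ M) ⊆ᴳ (G ─ᴱ M)
  F⊆G─M a b h with ∧-true (adj H a b) h
  ... | hab , not-mab rewrite H⊆G a b hab = not-mab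
  F-regular : IsRegular (δ ∸ 1) (H ─ᴱ M)
  F-regular v = trans (degree≡deg (H ─ᴱ M) v) (trans (sym (m+n∸n≡m _ 1)) (cong (_∸ 1) (begin-equality
    deg (H ─ᴱ M) v + 1                                 ≡⟨ cong (deg (H ─ᴱ M) v +_) (sym (𝟙-not (A v))) ⟩
    deg (H ─ᴱ M) v + (𝟙 (A v) + 𝟙 (not (A v)))         ≡⟨ +-assoc (deg (H ─ᴱ M) v) _ _ ⟨
    deg (H ─ᴱ M) v + 𝟙 (A v) + 𝟙 (not (A v))           ≡⟨ cong (λ d → deg (H ─ᴱ M) v + d + 𝟙 (not (A v))) (deg-M v) ⟨
    deg (H ─ᴱ M) v + deg M v + 𝟙 (not (A v))           ≡⟨ cong (_+ 𝟙 (not (A v))) (deg-─ H M M⊆H v) ⟩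
    deg H v + 𝟙 (not (A v))                            ≡⟨ deg-H v ⟩
    δ                                                  ∎)))

even-set-avoiding : ∀ {n} (w : Fin n) →
  ∃ λ A → (∀ z → A z ≡ false → z ≡ w) × count (not ∘ A) ≡ n % 2 × 2 ∣ count A
even-set-avoiding {n} w =
  let (A , only-w , outside) = avoid in
  A , only-w , outside , divides (n / 2) (+-cancelʳ-≡ (n % 2) _ _ (begin
    count A + n % 2             ≡⟨ cong (count A +_) outside ⟨
    count A + count (not ∘ A)   ≡⟨ count-complement A ⟩
    n                           ≡⟨ m≡m%n+[m/n]*n n 2 ⟩
    n % 2 + n / 2 * 2           ≡⟨ +-comm (n % 2) _ ⟩
    n / 2 * 2 + n % 2           ∎))
  where
  open ≡-Reasoning
  avoid : ∃ λ A → (∀ z → A z ≡ false → z ≡ w) × count (not ∘ A) ≡ n % 2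
  avoid with n % 2 | m%n<n n 2
  ... | 0 | _ = (λ _ → true) , (λ z ()) , count-none {n} (λ _ → false) (λ _ → refl)
  ... | 1 | _ = (λ z → not (z == w)) , (λ z h → ==⇒≡ (not-false h)) ,
                trans (sum-cong-≗ (λ z → cong 𝟙 (Bool.not-involutive (z == w)))) (count-== w)
  ... | suc (suc _) | s≤s (s≤s ())

-- (t + m)(m + 2) ≤ 3t + 2tm whenever m < t: this turns the hypothesis of
-- Lemma 5.5 into the size condition of the dense f-factor lemma
product-bound : ∀ t m → m + 1 ≤ t → (t + m) * (m + 2) ≤ 3 * t + 2 * t * m
product-bound t m m<t with t ∸ (m + 1) | m+[n∸m]≡n m<t
... | r | refl = ≤-trans (m≤m+n _ (1 + r + r * m)) (≤-reflexive (expand m r))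
  where
  expand : ∀ m r → (m + 1 + r + m) * (m + 2) + (1 + r + r * m) ≡ 3 * (m + 1 + r) + 2 * (m + 1 + r) * m
  expand = solve-∀

-- Parity of a + nδ: for even δ the term nδ is even, for odd δ it has the
-- parity of n.
even-δ-parity : ∀ a n δ → δ % 2 ≡ 0 → 2 ∣ a + n * δ → 2 ∣ a
even-δ-parity a n δ δ-even 2∣a+nδ =
  ∣m+n∣m⇒∣n (subst (2 ∣_) (+-comm a (n * δ)) 2∣a+nδ) (∣n⇒∣m*n n (m%n≡0⇒n∣m δ 2 δ-even))

odd-δ-parity : ∀ a n δ → δ % 2 ≡ 1 → 2 ∣ a + n * δ → 2 ∣ a + n % 2
odd-δ-parity a n δ δ-odd 2∣a+nδ =
  ∣m+n∣m⇒∣n (subst (2 ∣_) (trans (cong (a +_) nδ) (rearrange a (n % 2) k)) 2∣a+nδ) (divides k refl)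
  where
  open ≡-Reasoning
  q = δ / 2
  k = n / 2 + n * q
  rearrange : ∀ a r k → a + (r + k * 2) ≡ k * 2 + (a + r)
  rearrange = solve-∀
  distribute : ∀ n q → n * (1 + q * 2) ≡ n + n * q * 2
  distribute = solve-∀
  collect : ∀ r p k → r + p * 2 + k * 2 ≡ r + (p + k) * 2
  collect = solve-∀
  nδ : n * δ ≡ n % 2 + k * 2
  nδ = begin
    n * δ                         ≡⟨ cong (n *_) (trans (m≡m%n+[m/n]*n δ 2) (cong (_+ q * 2) δ-odd)) ⟩
    n * (1 + q * 2)               ≡⟨ distribute n q ⟩
    n + n * q * 2                 ≡⟨ cong (_+ n * q * 2) (m≡m%n+[m/n]*n n 2) ⟩
    n % 2 + n / 2 * 2 + n * q * 2 ≡⟨ collect (n % 2) (n / 2) (n * q) ⟩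
    n % 2 + k * 2                 ∎

-- The setting of Lemma 5.5.  With m = Δ − δ and f = deg G − δ, the hypotheses
-- give exactly what the dense f-factor lemma needs: every vertex misses at
-- most t others, f ≤ m, f vanishes on s vertices, and s + (t+m)(m+2) ≤ n.
module Lemma5p5 (s t n : ℕ) (G : Graph n) (δ Δ : ℕ) (min-δ : IsMinDegree G δ) (max-Δ : IsMaxDegree G Δ)
  (n∸t≤δ : n ∸ t ≤ δ) (s-def : s ≡ numVerticesOfDegree G δ) (n-large : s + 3 * t + 2 * t * (Δ ∸ δ) ≤ n) where

  open ≤-Reasoning

  δ≤deg : ∀ v → δ ≤ deg G v
  δ≤deg v = subst (δ ≤_) (degree≡deg G v) (proj₂ min-δ v)

  deg≤Δ : ∀ v → deg G v ≤ Δ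
  deg≤Δ v = subst (_≤ Δ) (degree≡deg G v) (proj₂ max-Δ v)

  m : ℕ
  m = Δ ∸ δ

  f : Fin n → ℕ
  f v = deg G v ∸ δ

  f≤m : ∀ v → f v ≤ m
  f≤m v = ∸-monoˡ-≤ δ (deg≤Δ v)

  v₀ : Fin n
  v₀ = proj₁ (proj₁ min-δ)

  f-v₀ : f v₀ ≡ 0
  f-v₀ = trans (cong (_∸ δ) (trans (sym (degree≡deg G v₀)) (proj₂ (proj₁ min-δ)))) (n∸n≡0 δ)

  n≤δ+t : n ≤ δ + t
  n≤δ+t = ≤-trans (m≤n+m∸n n t) (≤-trans (+-monoʳ-≤ t n∸t≤δ) (≤-reflexive (+-comm t δ)))

  dense : ∀ v → n ≤ deg G v + t
  dense v = ≤-trans n≤δ+t (+-monoˡ-≤ t (δ≤deg v))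

  zeros-of-f : count (λ v → f v ≡ᵇ 0) ≡ s
  zeros-of-f = trans (sum-cong-≗ (λ v → cong 𝟙 (zero-iff v)))
                     (trans (sym (countᵇ≡count (λ v → degree G v ≡ᵇ δ))) (sym s-def))
    where
    ∸≡ᵇ0 : ∀ a b → b ≤ a → ((a ∸ b) ≡ᵇ 0) ≡ (a ≡ᵇ b)
    ∸≡ᵇ0 a       zero    _         = refl
    ∸≡ᵇ0 (suc a) (suc b) (s≤s b≤a) = ∸≡ᵇ0 a b b≤a
    zero-iff : ∀ v → (f v ≡ᵇ 0) ≡ (degree G v ≡ᵇ δ)
    zero-iff v = trans (∸≡ᵇ0 (deg G v) δ (δ≤deg v)) (cong (_≡ᵇ δ) (sym (degree≡deg G v)))

  -- Δ < n ≤ δ + t, so m < t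
  m<t : m + 1 ≤ t
  m<t = +-cancelˡ-≤ δ _ _ (begin
    δ + (m + 1)   ≡⟨ +-assoc δ m 1 ⟨
    δ + m + 1     ≡⟨ cong (_+ 1) (m+[n∸m]≡n (≤-trans (δ≤deg v₀) (deg≤Δ v₀))) ⟩
    Δ + 1         ≡⟨ cong (_+ 1) (trans (sym (proj₂ (proj₁ max-Δ))) (degree≡deg G vΔ)) ⟩
    deg G vΔ + 1  ≤⟨ deg<n G vΔ ⟩
    n             ≤⟨ n≤δ+t ⟩
    δ + t         ∎)
    where
    vΔ = proj₁ (proj₁ max-Δ)

  budget : s + (t + m) * (m + 2) ≤ n
  budget = ≤-trans (+-monoʳ-≤ s (product-bound t m m<t)) (≤-trans (≤-reflexive (sym (+-assoc s (3 * t) _))) n-large)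

  1≤s : 1 ≤ s
  1≤s = subst (1 ≤_) zeros-of-f
    (≤-trans (≤-reflexive (cong (λ a → 𝟙 (a ≡ᵇ 0)) (sym f-v₀))) (term≤sum (λ v → 𝟙 (f v ≡ᵇ 0)) v₀))

  -- G is not regular: otherwise s = n, leaving no room for 3t ≥ 3
  1≤m : 1 ≤ m
  1≤m = n≢0⇒n>0 irregular
    where
    irregular : m ≢ 0
    irregular m≡0 = <-irrefl refl (<-≤-trans n<n (≤-trans (m≤m+n _ _) n-large))
      where
      all-zero : ∀ v → (f v ≡ᵇ 0) ≡ true
      all-zero v rewrite n≤0⇒n≡0 (subst (f v ≤_) m≡0 (f≤m v)) = refl
      s≡n : s ≡ n
      s≡n = trans (sym zeros-of-f) (trans (sum-cong-≗ (λ v → cong 𝟙 (all-zero v))) (trans (sum-const n 1) (*-identityʳ n)))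
      n<n : n < s + 3 * t
      n<n = subst (λ c → n < c + 3 * t) (sym s≡n) (m<m+n n (≤-trans (s≤s z≤n) (*-monoʳ-≤ 3 (≤-trans (m≤n+m 1 m) m<t))))

  δ-large : n + 1 ≤ δ + δ
  δ-large = begin
    n + 1         ≤⟨ +-monoˡ-≤ 1 n≤δ+t ⟩
    δ + t + 1     ≡⟨ +-assoc δ t 1 ⟩
    δ + (t + 1)   ≤⟨ +-monoʳ-≤ δ t<δ ⟩
    δ + δ         ∎
    where
    -- 1 + 3t ≤ s + 3t ≤ n ≤ δ + t
    t<δ : t + 1 ≤ δ
    t<δ = +-cancelʳ-≤ t _ _ (begin
      t + 1 + t       ≤⟨ m≤m+n (t + 1 + t) t ⟩
      t + 1 + t + t   ≡⟨ rearrange t ⟩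
      1 + 3 * t       ≤⟨ +-monoˡ-≤ (3 * t) 1≤s ⟩
      s + 3 * t       ≤⟨ ≤-trans (m≤m+n _ _) n-large ⟩
      n               ≤⟨ n≤δ+t ⟩
      δ + t           ∎)
      where
      rearrange : ∀ t → t + 1 + t + t ≡ 1 + 3 * t
      rearrange = solve-∀

  -- Σ f + nδ = Σ deg G is even
  parity : 2 ∣ sum f + n * δ
  parity = subst (2 ∣_) (sym (begin-equality
    sum f + n * δ             ≡⟨ cong (sum f +_) (sum-const n δ) ⟨
    sum f + sum {n} (λ _ → δ) ≡⟨ ∑-distrib-+ f (λ _ → δ) ⟨
    sum (λ v → f v + δ)       ≡⟨ sum-cong-≗ (λ v → m∸n+n≡m (δ≤deg v)) ⟩
    sum (deg G)               ∎)) (degree-sum-even G)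

  f-factor : ∀ {g : Fin n → ℕ} → (∀ v → g v ≤ m) → count (λ v → g v ≡ᵇ 0) ≤ s → 2 ∣ sum g →
    ∃ λ K → K ⊆ᴳ G × (∀ z → deg K z ≡ g z)
  f-factor {g} g≤m zeros = DenseFactor.dense-factor G t m s g dense g≤m zeros budget

  part-a : δ % 2 ≡ 0 → HasFactor δ G
  part-a δ-even =
    let (K , K⊆G , deg-K) = f-factor f≤m (≤-reflexive zeros-of-f) Σf-even
    in G ─ᴱ K , ─⊆ G K ,
       regular-remainder G K K⊆G (λ v → trans (cong (_+ δ) (deg-K v)) (m∸n+n≡m (δ≤deg v)))
    where
    Σf-even : 2 ∣ sum f
    Σf-even = even-δ-parity (sum f) n δ δ-even parity

  part-b : δ % 2 ≡ 1 → ∃ λ M → IsOptimalMatching G M × HasFactor (δ ∸ 1) (G ─ᴱ M)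
  part-b δ-odd =
    let (K , K⊆G , deg-K) = f-factor f'≤m zeros' Σf'-even
    in matching-with-factor G (G ─ᴱ K) A δ (─⊆ G K) (deg-remainder K K⊆G deg-K)
         (≤-trans (≤-reflexive outside) (≤-pred (m%n<n n 2))) A-even δ-large
    where
    avoiding = even-set-avoiding v₀
    A = proj₁ avoiding
    only-v₀ = proj₁ (proj₂ avoiding)
    outside = proj₁ (proj₂ (proj₂ avoiding))
    A-even = proj₂ (proj₂ (proj₂ avoiding))
    -- off A (i.e. possibly at v₀) the target degree is lowered by one more
    f' : Fin n → ℕ
    f' z = f z + 𝟙 (not (A z))
    f'≤m : ∀ z → f' z ≤ m
    f'≤m z with A z in az
    ... | true  = subst (_≤ m) (sym (+-identityʳ (f z))) (f≤m z)
    ... | false = subst (λ w → f w + 1 ≤ m) (sym (only-v₀ z az)) (subst (λ a → a + 1 ≤ m) (sym f-v₀) 1≤m)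
    zeros' : count (λ z → f' z ≡ᵇ 0) ≤ s
    zeros' = ≤-trans (count-mono (λ z → f' z ≡ᵇ 0) (λ z → f z ≡ᵇ 0) (λ z → summand-zero (f z)))
                     (≤-reflexive zeros-of-f)
      where
      summand-zero : ∀ a {b} → ((a + b) ≡ᵇ 0) ≡ true → (a ≡ᵇ 0) ≡ true
      summand-zero zero _ = refl
    Σf'-even : 2 ∣ sum f'
    Σf'-even = subst (2 ∣_) (sym (trans (∑-distrib-+ f (λ z → 𝟙 (not (A z)))) (cong (sum f +_) outside)))
                     (odd-δ-parity (sum f) n δ δ-odd parity)
    deg-remainder : ∀ K → K ⊆ᴳ G → (∀ z → deg K z ≡ f' z) → ∀ z → deg (G ─ᴱ K) z + 𝟙 (not (A z)) ≡ δ
    deg-remainder K K⊆G deg-K z = +-cancelʳ-≡ (f z) _ _ (begin-equality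
      deg (G ─ᴱ K) z + 𝟙 (not (A z)) + f z  ≡⟨ +-assoc (deg (G ─ᴱ K) z) _ _ ⟩
      deg (G ─ᴱ K) z + (𝟙 (not (A z)) + f z) ≡⟨ cong (deg (G ─ᴱ K) z +_) (trans (+-comm _ (f z)) (sym (deg-K z))) ⟩
      deg (G ─ᴱ K) z + deg K z               ≡⟨ deg-─ G K K⊆G z ⟩
      deg G z                                ≡⟨ m+[n∸m]≡n (δ≤deg z) ⟨
      δ + f z                                ∎)

lemma5p5 : (s t n : ℕ) (G : Graph n) (δ Δ : ℕ) →
    IsMinDegree G δ → IsMaxDegree G Δ →
    n ∸ t ≤ δ →
    s ≡ numVerticesOfDegree G δ →
    s + 3 * t + 2 * t * (Δ ∸ δ) ≤ n →
    (δ % 2 ≡ 0 → HasFactor δ G) ×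
    (δ % 2 ≡ 1 → ∃ λ (M : Graph n) → IsOptimalMatching G M × HasFactor (δ ∸ 1) (G ─ᴱ M))
lemma5p5 s t n G δ Δ min-δ max-Δ n∸t≤δ s-def n-large = part-a , part-b
  where open Lemma5p5 s t n G δ Δ min-δ max-Δ n∸t≤δ s-def n-large
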